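{- Let $T$ be a tree on $n$ vertices that is not isomorphic to the path $P_n$. Then there is a pendent vertex $v$ of $T$ such that for every vertex $u\neq v$ of $T$, $$\varepsilon_T(u)=\varepsilon_{T-v}(u).$$
   Context: For a connected graph $H$ and a vertex $u$ of $H$, $\varepsilon_H(u)=\max_{x\in V(H)} d_H(u,x)$ is the eccentricity of $u$ in $H$, where $d_H$ is the shortest-path distance in $H$. A pendent vertex is a vertex of degree $1$; $T-v$ is the tree obtained by deleting $v$. -}

module Defs where

open import Data.Nat using (ℕ; zero; suc; _≤_)
open import Data.Fin using (Fin; punchIn)
open import Data.Bool using (Bool; T)
open import Data.List using (List; []; _∷_; length; filter; allFin; last)
open import Data.List.Relation.Unary.Unique.Propositional using (Unique)
open import Data.Maybe using (just)
open import Data.Product using (Σ; ∃; _×_; _,_)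
open import Function.Bundles using (Bijection; _⇔_)
open import Relation.Binary.PropositionalEquality using (_≡_)
open import Relation.Nullary using (¬_)
open import Data.Bool.Properties using (T?; T-∨; ∨-comm)
open import Data.Bool using (_∨_)
open import Data.Nat using (_≡ᵇ_)
open import Data.Nat.Properties using (≡ᵇ⇒≡; 1+n≢n)
open import Data.Fin using (toℕ)
open import Data.Sum using (inj₁; inj₂)
open import Function.Bundles using (Equivalence)
open import Relation.Binary.PropositionalEquality using (setoid) renaming (sym to sym≡)
open import Relation.Binary.PropositionalEquality using () renaming (setoid to ≡-setoid)

record Graph (n : ℕ) : Set where
  field
    adj   : Fin n → Fin n → Bool
    sym   : ∀ i j → adj i j ≡ adj j i
    irrefl : ∀ i → ¬ T (adj i i)

open Graph public

Adj : ∀ {n} → Graph n → Fin n → Fin n → Set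
Adj G i j = T (adj G i j)

degree : ∀ {n} → Graph n → Fin n → ℕ
degree {n} G v = length (filter (λ w → T? (adj G v w)) (allFin n))

Pendent : ∀ {n} → Graph n → Fin n → Set
Pendent G v = degree G v ≡ 1

data Walk {n} (G : Graph n) : Fin n → Fin n → ℕ → Set where
  here : ∀ {u} → Walk G u u 0
  step : ∀ {u w v k} → Adj G u w → Walk G w v k → Walk G u v (suc k)

Connected : ∀ {n} → Graph n → Set
Connected G = ∀ u v → ∃ λ k → Walk G u v k

data IsWalkList {n} (G : Graph n) : List (Fin n) → Set where
  nil  : IsWalkList G []
  one  : ∀ {x} → IsWalkList G (x ∷ [])
  cons : ∀ {x y xs} → Adj G x y → IsWalkList G (y ∷ xs) → IsWalkList G (x ∷ y ∷ xs)

HasCycle : ∀ {n} → Graph n → Set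
HasCycle {n} G = Σ (Fin n) λ x → Σ (List (Fin n)) λ xs → Σ (Fin n) λ y →
  3 ≤ length (x ∷ xs) × Unique (x ∷ xs) × IsWalkList G (x ∷ xs) ×
  last (x ∷ xs) ≡ just y × Adj G y x

IsTree : ∀ {n} → Graph n → Set
IsTree G = Connected G × ¬ HasCycle G

IsDist : ∀ {n} → Graph n → Fin n → Fin n → ℕ → Set
IsDist G u x k = Walk G u x k × (∀ m → Walk G u x m → k ≤ m)

IsEcc : ∀ {n} → Graph n → Fin n → ℕ → Set
IsEcc {n} G u e = (∀ x k → IsDist G u x k → k ≤ e) × (∃ λ x → IsDist G u x e)

pathAdj : ∀ {n} → Fin n → Fin n → Bool
pathAdj i j = (suc (toℕ i) ≡ᵇ toℕ j) ∨ (suc (toℕ j) ≡ᵇ toℕ i)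

private
  noSelf : ∀ k → ¬ T (suc k ≡ᵇ k)
  noSelf k t = 1+n≢n (≡ᵇ⇒≡ (suc k) k t)

  pathIrrefl : ∀ {n} (i : Fin n) → ¬ T (pathAdj i i)
  pathIrrefl i t with T-∨ .Equivalence.to t
  ... | inj₁ p = noSelf (toℕ i) p
  ... | inj₂ p = noSelf (toℕ i) p

P : (n : ℕ) → Graph n
P n = record
  { adj = pathAdj
  ; sym = λ i j → ∨-comm (suc (toℕ i) ≡ᵇ toℕ j) (suc (toℕ j) ≡ᵇ toℕ i)
  ; irrefl = pathIrrefl }

_≅_ : ∀ {n} → Graph n → Graph n → Set
_≅_ {n} G H = Σ (Bijection (≡-setoid (Fin n)) (≡-setoid (Fin n))) λ f →
  ∀ i j → adj G i j ≡ adj H (Bijection.to f i) (Bijection.to f j)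

-- T - v : delete vertex v; the vertices of T - v are indexed by Fin n,
-- vertex i of T - v being vertex (punchIn v i) of T
_-_ : ∀ {n} → Graph (suc n) → Fin (suc n) → Graph n
G - v = record
  { adj = λ i j → adj G (punchIn v i) (punchIn v j)
  ; sym = λ i j → sym G (punchIn v i) (punchIn v j)
  ; irrefl = λ i → irrefl G (punchIn v i) }

-- If some vertex c has degree at least 3, take three of its neighbours and the branches of T at c
-- through them, and let v be a vertex farthest from c in a branch of least height. Then v is
-- pendent, and every u ≠ v misses one of the two other branches; if x is a vertex of that branch
-- farthest from c, then d(u,v) ≤ d(u,c) + d(c,v) ≤ d(u,c) + d(c,x) = d(u,x). So v is never the
-- unique farthest vertex from any u, and since deleting a pendent vertex changes no other
-- distance, no eccentricity changes either.
-- If every vertex has degree at most 2, let a be a vertex farthest from some vertex. Then a is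
-- pendent, the distance from a is injective, and it numbers the vertices along a copy of P_n.
module Submission where

open import Defs hiding (sym)
open import Data.Bool using (Bool; true; false; T)
open import Data.Bool.Properties using (T?; T-∨)
open import Data.Empty using (⊥; ⊥-elim)
open import Data.Fin using (Fin; punchIn; punchOut; toℕ; fromℕ<) renaming (zero to fzero)
open import Data.Fin.Properties
  using (punchIn-injective; punchInᵢ≢i; punchIn-punchOut; toℕ-injective; toℕ-fromℕ<; toℕ<n; any?; injective⇒≤)
  renaming (_≟_ to _≟ᶠ_)
open import Data.List using (List; []; _∷_; length; filter; allFin; last; map)
open import Data.List.Extrema.Nat using (argmax; f[xs]≤f[argmax]; argmax-all)
open import Data.List.Membership.Propositional using (_∈_)
open import Data.List.Membership.Propositional.Properties using (∈-filter⁺; ∈-filter⁻; ∈-allFin)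
open import Data.List.Properties using (length-map)
open import Data.List.Relation.Unary.All using (All; []; _∷_; lookup; universal)
open import Data.List.Relation.Unary.All.Properties using (¬Any⇒All¬; all-filter) renaming (map⁺ to All-map⁺)
open import Data.List.Relation.Unary.AllPairs using ([]; _∷_)
open import Data.List.Relation.Unary.Any using (here; there)
import Data.List.Relation.Unary.Any as Any
open import Data.List.Relation.Unary.Unique.Propositional using (Unique)
open import Data.List.Relation.Unary.Unique.Propositional.Properties
  using (filter⁺; allFin⁺) renaming (map⁺ to Unique-map⁺)
open import Data.Maybe using (just)
open import Data.Nat using (ℕ; zero; suc; _+_; _≤_; _<_; z≤n; s≤s; _≤?_; _<?_; _≟_)
open import Data.Nat.Properties
open import Data.Product using (Σ; ∃; _×_; _,_; proj₁; proj₂)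
open import Data.Sum using (_⊎_; inj₁; inj₂)
import Data.Sum as Sum
open import Function.Bundles using (_⇔_; mk⇔; mk⤖; Equivalence)
open import Relation.Binary.Definitions using (tri<; tri≈; tri>)
open import Relation.Binary.PropositionalEquality using (_≡_; _≢_; refl; sym; trans; cong; subst; subst₂; ≢-sym)
open import Relation.Nullary using (¬_; Dec; yes; no)
open import Relation.Nullary.Decidable using (_×-dec_)
open import Relation.Unary using (Pred; Decidable)

Distinct₃ : ∀ {a p} {A : Set a} → Pred A p → Set _
Distinct₃ {A = A} P = Σ A λ x → Σ A λ y → Σ A λ z → P x × P y × P z × x ≢ y × x ≢ z × y ≢ z

Distinct₃-map : ∀ {a p q} {A : Set a} {P : Pred A p} {Q : Pred A q} →
                (∀ {x} → P x → Q x) → Distinct₃ P → Distinct₃ Q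
Distinct₃-map f (x , y , z , px , py , pz , x≢y , x≢z , y≢z) =
  x , y , z , f px , f py , f pz , x≢y , x≢z , y≢z

module _ {a} {A : Set a} where

  3≤length⇒Distinct₃ : ∀ {L : List A} → Unique L → 3 ≤ length L → Distinct₃ (_∈ L)
  3≤length⇒Distinct₃ {[]}          _ ()
  3≤length⇒Distinct₃ {_ ∷ []}      _ (s≤s ())
  3≤length⇒Distinct₃ {_ ∷ _ ∷ []}  _ (s≤s (s≤s ()))
  3≤length⇒Distinct₃ {x ∷ y ∷ z ∷ _} ((x≢y ∷ x≢z ∷ _) ∷ (y≢z ∷ _) ∷ _) _ =
    x , y , z , here refl , there (here refl) , there (there (here refl)) , x≢y , x≢z , y≢z

  Distinct₃⇒3≤length : ∀ {L : List A} → Distinct₃ (_∈ L) → 3 ≤ length L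
  Distinct₃⇒3≤length {_ ∷ _ ∷ _ ∷ _} _ = s≤s (s≤s (s≤s z≤n))
  Distinct₃⇒3≤length {_ ∷ []} (_ , _ , _ , here refl , here refl , _ , x≢y , _) = ⊥-elim (x≢y refl)
  Distinct₃⇒3≤length {_ ∷ _ ∷ []} (_ , _ , _ , x∈ , y∈ , z∈ , x≢y , x≢z , y≢z)
    with ∈-pair x∈ | ∈-pair y∈ | ∈-pair z∈
    where
    ∈-pair : ∀ {w b c} → w ∈ b ∷ c ∷ [] → w ≡ b ⊎ w ≡ c
    ∈-pair (here refl)         = inj₁ refl
    ∈-pair (there (here refl)) = inj₂ refl
  ... | inj₁ refl | inj₁ refl | _         = ⊥-elim (x≢y refl)
  ... | inj₂ refl | inj₂ refl | _         = ⊥-elim (x≢y refl)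
  ... | inj₁ refl | _         | inj₁ refl = ⊥-elim (x≢z refl)
  ... | inj₂ refl | _         | inj₂ refl = ⊥-elim (x≢z refl)
  ... | _         | inj₁ refl | inj₁ refl = ⊥-elim (y≢z refl)
  ... | _         | inj₂ refl | inj₂ refl = ⊥-elim (y≢z refl)

  all≡⇒length≡1 : ∀ {L : List A} {y} → Unique L → y ∈ L → (∀ {z} → z ∈ L → z ≡ y) → length L ≡ 1
  all≡⇒length≡1 {_ ∷ []} _ _ _ = refl
  all≡⇒length≡1 {_ ∷ _ ∷ _} ((x≢x′ ∷ _) ∷ _) _ all≡ =
    ⊥-elim (x≢x′ (trans (all≡ (here refl)) (sym (all≡ (there (here refl))))))

least-witness : ∀ {p} {Q : Pred ℕ p} → Decidable Q → ∀ k → Q k → Σ ℕ λ j → Q j × (∀ l → Q l → j ≤ l)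
least-witness Q? zero q = 0 , q , λ _ _ → z≤n
least-witness Q? (suc k) q with Q? 0
... | yes q₀ = 0 , q₀ , λ _ _ → z≤n
... | no ¬q₀ with least-witness (λ l → Q? (suc l)) k q
...   | j , qj , least = suc j , qj , λ { zero q₀ → ⊥-elim (¬q₀ q₀) ; (suc l) ql → s≤s (least l ql) }

-- Abstract so that unification never unfolds argmax over allFin.
abstract
  maximiser : ∀ {n p} {Q : Pred (Fin n) p} → Decidable Q → (f : Fin n → ℕ) → ∀ {x₀} → Q x₀ →
              Σ (Fin n) λ x → Q x × (∀ y → Q y → f y ≤ f x)
  maximiser {n} Q? f {x₀} q₀ =
    argmax f x₀ xs , argmax-all f q₀ (all-filter Q? (allFin n)) ,
    λ y qy → lookup (f[xs]≤f[argmax] {f = f} x₀ xs) (∈-filter⁺ Q? (∈-allFin y) qy)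
    where
    xs : List (Fin n)
    xs = filter Q? (allFin n)

  maximiser-all : ∀ {n} (f : Fin (suc n) → ℕ) → Σ (Fin (suc n)) λ x → ∀ y → f y ≤ f x
  maximiser-all {n} f = argmax f fzero (allFin (suc n)) ,
    λ y → lookup (f[xs]≤f[argmax] {f = f} fzero (allFin (suc n))) (∈-allFin y)

T⇔T⇒≡ : ∀ {b c : Bool} → (T b → T c) → (T c → T b) → b ≡ c
T⇔T⇒≡ {false} {false} _ _ = refl
T⇔T⇒≡ {false} {true}  _ g = ⊥-elim (g _)
T⇔T⇒≡ {true}  {false} f _ = ⊥-elim (f _)
T⇔T⇒≡ {true}  {true}  _ _ = refl

unpunch : ∀ {m} (c : Fin (suc m)) {x} → c ≢ x → ∃ λ x′ → punchIn c x′ ≡ x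
unpunch c c≢x = punchOut c≢x , punchIn-punchOut c≢x

Consecutive : ℕ → ℕ → Set
Consecutive i j = suc i ≡ j ⊎ suc j ≡ i

Adj-P⇔ : ∀ {n} {i j : Fin n} → Adj (P n) i j ⇔ Consecutive (toℕ i) (toℕ j)
Adj-P⇔ = mk⇔ (λ t → Sum.map (≡ᵇ⇒≡ _ _) (≡ᵇ⇒≡ _ _) (Equivalence.to T-∨ t))
             (λ c → Equivalence.from T-∨ (Sum.map (≡⇒≡ᵇ _ _) (≡⇒≡ᵇ _ _) c))

module _ {n : ℕ} (G : Graph n) where

  Adj-sym : ∀ {u w} → Adj G u w → Adj G w u
  Adj-sym {u} {w} = subst T (Graph.sym G u w)

  Adj⇒≢ : ∀ {u w} → Adj G u w → u ≢ w
  Adj⇒≢ {u} a refl = irrefl G u a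

module _ {n : ℕ} {G : Graph n} where

  _++ʷ_ : ∀ {u y x a b} → Walk G u y a → Walk G y x b → Walk G u x (a + b)
  here     ++ʷ q = q
  step e p ++ʷ q = step e (p ++ʷ q)

  reverseʷ : ∀ {u x k} → Walk G u x k → Walk G x u k
  reverseʷ here = here
  reverseʷ (step {k = k} e p) = subst (Walk G _ _) (+-comm k 1) (reverseʷ p ++ʷ step (Adj-sym G e) here)

  walk₀⇒≡ : ∀ {u x} → Walk G u x 0 → u ≡ x
  walk₀⇒≡ here = refl

  ≢⇒walk-nonempty : ∀ {u x k} → u ≢ x → Walk G u x k → 0 < k
  ≢⇒walk-nonempty u≢x here       = ⊥-elim (u≢x refl)
  ≢⇒walk-nonempty u≢x (step _ _) = s≤s z≤n

  ≢⇒neighbour : ∀ {u x k} → u ≢ x → Walk G u x k → ∃ (Adj G u)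
  ≢⇒neighbour u≢x here       = ⊥-elim (u≢x refl)
  ≢⇒neighbour u≢x (step e _) = _ , e

  first-step : ∀ {u x k} → Walk G u x (suc k) → Σ (Fin n) λ w → Adj G u w × Walk G w x k
  first-step (step e p) = _ , e , p

  last-step : ∀ {u x k} → Walk G u x (suc k) → Σ (Fin n) λ w → Walk G u w k × Adj G w x
  last-step (step e here) = _ , here , e
  last-step (step e (step e′ p)) with last-step (step e′ p)
  ... | w , q , a = w , step e q , a

walk? : ∀ {n} (G : Graph n) k u x → Dec (Walk G u x k)
walk? G zero u x with u ≟ᶠ x
... | yes refl = yes here
... | no u≢x   = no λ { here → u≢x refl }
walk? G (suc k) u x with any? (λ w → T? (adj G u w) ×-dec walk? G k w x)
... | yes (w , e , p) = yes (step e p)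
... | no ¬step        = no λ { (step e p) → ¬step (_ , e , p) }

module Distance {n : ℕ} (G : Graph n) (connected : Connected G) where

  abstract
    shortest-walk : ∀ u x → Σ ℕ λ k → Walk G u x k × (∀ l → Walk G u x l → k ≤ l)
    shortest-walk u x = least-witness (λ k → walk? G k u x) (proj₁ (connected u x)) (proj₂ (connected u x))

  dist : Fin n → Fin n → ℕ
  dist u x = proj₁ (shortest-walk u x)

  dist-walk : ∀ u x → Walk G u x (dist u x)
  dist-walk u x = proj₁ (proj₂ (shortest-walk u x))

  dist-minimal : ∀ {u x k} → Walk G u x k → dist u x ≤ k
  dist-minimal {u} {x} {k} = proj₂ (proj₂ (shortest-walk u x)) k

  dist-isDist : ∀ u x → IsDist G u x (dist u x)
  dist-isDist u x = dist-walk u x , λ _ → dist-minimal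

  isDist⇒≡dist : ∀ {u x k} → IsDist G u x k → k ≡ dist u x
  isDist⇒≡dist (p , minimal) = ≤-antisym (minimal _ (dist-walk _ _)) (dist-minimal p)

  dist-refl : ∀ u → dist u u ≡ 0
  dist-refl u = n≤0⇒n≡0 (dist-minimal (here {u = u}))

  dist≡0⇒≡ : ∀ {u x} → dist u x ≡ 0 → u ≡ x
  dist≡0⇒≡ {u} {x} eq = walk₀⇒≡ (subst (Walk G u x) eq (dist-walk u x))

  ≢⇒dist-pos : ∀ {u x} → u ≢ x → 0 < dist u x
  ≢⇒dist-pos u≢x = ≢⇒walk-nonempty u≢x (dist-walk _ _)

  dist-triangle : ∀ u y x → dist u x ≤ dist u y + dist y x
  dist-triangle u y x = dist-minimal (dist-walk u y ++ʷ dist-walk y x)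

  dist-adj : ∀ u {y x} → Adj G y x → dist u x ≤ suc (dist u y)
  dist-adj u {y} {x} e = subst (dist u x ≤_) (+-comm (dist u y) 1) (dist-minimal (dist-walk u y ++ʷ step e here))

  predecessor : ∀ u x {k} → dist u x ≡ suc k → Σ (Fin n) λ p → Adj G p x × dist u p ≡ k
  predecessor u x eq with last-step (subst (Walk G u x) eq (dist-walk u x))
  ... | p , q , a = p , a , ≤-antisym (dist-minimal q) (≤-pred (subst (_≤ suc (dist u p)) eq (dist-adj u a)))

module Neighbours {n : ℕ} (G : Graph n) (v : Fin n) where

  neighbours : List (Fin n)
  neighbours = filter (λ w → T? (adj G v w)) (allFin n)

  neighbours-unique : Unique neighbours
  neighbours-unique = filter⁺ (λ w → T? (adj G v w)) (allFin⁺ n)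

  ∈-neighbours⁺ : ∀ {w} → Adj G v w → w ∈ neighbours
  ∈-neighbours⁺ {w} = ∈-filter⁺ (λ w → T? (adj G v w)) (∈-allFin w)

  ∈-neighbours⁻ : ∀ {w} → w ∈ neighbours → Adj G v w
  ∈-neighbours⁻ w∈ = proj₂ (∈-filter⁻ (λ w → T? (adj G v w)) {xs = allFin n} w∈)

  degree≥3⇒Distinct₃ : 3 ≤ degree G v → Distinct₃ (Adj G v)
  degree≥3⇒Distinct₃ deg≥3 = Distinct₃-map ∈-neighbours⁻ (3≤length⇒Distinct₃ neighbours-unique deg≥3)

  Distinct₃⇒degree≥3 : Distinct₃ (Adj G v) → 3 ≤ degree G v
  Distinct₃⇒degree≥3 three = Distinct₃⇒3≤length (Distinct₃-map ∈-neighbours⁺ three)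

  unique-neighbour⇒pendent : ∀ {w} → Adj G v w → (∀ z → Adj G v z → z ≡ w) → Pendent G v
  unique-neighbour⇒pendent vw only-w =
    all≡⇒length≡1 neighbours-unique (∈-neighbours⁺ vw) (λ z∈ → only-w _ (∈-neighbours⁻ z∈))

open Neighbours using (degree≥3⇒Distinct₃; Distinct₃⇒degree≥3; unique-neighbour⇒pendent)

data Path {n : ℕ} (G : Graph n) : Fin n → Fin n → List (Fin n) → Set where
  trivial : ∀ {a} → Path G a a (a ∷ [])
  extend  : ∀ {a b c L} → Adj G a b → Path G b c L → Path G a c (a ∷ L)

module _ {n : ℕ} {G : Graph n} where

  suffix-path : ∀ {a b c L} → Path G b c L → Unique L → a ∈ L →
                Σ (List (Fin n)) λ L′ → Path G a c L′ × Unique L′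
  suffix-path trivial        u       (here refl) = _ , trivial , u
  suffix-path (extend e p)   u       (here refl) = _ , extend e p , u
  suffix-path (extend e p) (_ ∷ u) (there a∈)  = suffix-path p u a∈

  walk⇒unique-path : ∀ {a b k} → Walk G a b k → Σ (List (Fin n)) λ L → Path G a b L × Unique L
  walk⇒unique-path here = _ , trivial , [] ∷ []
  walk⇒unique-path (step {u = a} e p) with walk⇒unique-path p
  ... | L , path , u with Any.any? (a ≟ᶠ_) L
  ...   | yes a∈ = suffix-path path u a∈
  ...   | no a∉  = a ∷ L , extend e path , ¬Any⇒All¬ L a∉ ∷ u

  Path⇒IsWalkList : ∀ {a b L} → Path G a b L → IsWalkList G L
  Path⇒IsWalkList trivial                 = one
  Path⇒IsWalkList (extend e trivial)      = cons e one
  Path⇒IsWalkList (extend e (extend e′ p)) = cons e (Path⇒IsWalkList (extend e′ p))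

  Path-last : ∀ {a b L} → Path G a b L → last L ≡ just b
  Path-last trivial                  = refl
  Path-last (extend e trivial)       = refl
  Path-last (extend e (extend e′ p)) = Path-last (extend e′ p)

  Path-length≥2 : ∀ {a b L} → a ≢ b → Path G a b L → 2 ≤ length L
  Path-length≥2 a≢b trivial      = ⊥-elim (a≢b refl)
  Path-length≥2 a≢b (extend e trivial)      = s≤s (s≤s z≤n)
  Path-length≥2 a≢b (extend e (extend _ _)) = s≤s (s≤s z≤n)

module Deletion {m : ℕ} (G : Graph (suc m)) where

  liftʷ : ∀ c {a b k} → Walk (G - c) a b k → Walk G (punchIn c a) (punchIn c b) k
  liftʷ c here       = here
  liftʷ c (step e p) = step e (liftʷ c p)

  liftᵖ : ∀ c {a b L} → Path (G - c) a b L → Path G (punchIn c a) (punchIn c b) (map (punchIn c) L)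
  liftᵖ c trivial      = trivial
  liftᵖ c (extend e p) = extend e (liftᵖ c p)

  Through : Fin (suc m) → Fin (suc m) → Fin (suc m) → ℕ → Set
  Through c a b k = Σ ℕ λ k₁ → Σ ℕ λ k₂ → Walk G a c k₁ × Walk G c b k₂ × k₁ + k₂ ≡ k

  avoids-or-through : ∀ c {a b k} → Walk G a b k → ∀ a′ b′ → punchIn c a′ ≡ a → punchIn c b′ ≡ b →
                      Walk (G - c) a′ b′ k ⊎ Through c a b k
  avoids-or-through c here a′ b′ refl b≡ with punchIn-injective c a′ b′ (sym b≡)
  ... | refl = inj₁ here
  avoids-or-through c (step {w = w} e p) a′ b′ refl b≡ with c ≟ᶠ w
  ... | yes refl = inj₂ (1 , _ , step e here , p , refl)
  ... | no c≢w with unpunch c c≢w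
  ...   | w′ , refl with avoids-or-through c p w′ b′ refl b≡
  ...     | inj₁ q = inj₁ (step e q)
  ...     | inj₂ (k₁ , k₂ , q₁ , q₂ , k≡) = inj₂ (suc k₁ , k₂ , step e q₁ , q₂ , cong suc k≡)

  acyclic⇒neighbours-disconnected : ¬ HasCycle G → ∀ w {y′ z′ k} →
    Adj G w (punchIn w y′) → Adj G w (punchIn w z′) → punchIn w y′ ≢ punchIn w z′ → ¬ Walk (G - w) y′ z′ k
  acyclic⇒neighbours-disconnected acyclic w {y′} {z′} wy wz y≢z p with walk⇒unique-path p
  ... | L , path , unique =
    acyclic (w , map (punchIn w) L , punchIn w z′ , 3≤length , unique′ ,
             Path⇒IsWalkList cycle , Path-last cycle , Adj-sym G wz)
    where
    cycle : Path G w (punchIn w z′) (w ∷ map (punchIn w) L)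
    cycle = extend wy (liftᵖ w path)
    3≤length : 3 ≤ length (w ∷ map (punchIn w) L)
    3≤length = s≤s (subst (2 ≤_) (sym (length-map (punchIn w) L))
                               (Path-length≥2 (λ y′≡z′ → y≢z (cong (punchIn w) y′≡z′)) path))
    unique′ : Unique (w ∷ map (punchIn w) L)
    unique′ = All-map⁺ (universal (λ x → ≢-sym (punchInᵢ≢i w x)) L)
            ∷ Unique-map⁺ (punchIn-injective w _ _) unique

  -- A walk can only enter a pendent vertex v from its neighbour w and must return to w,
  -- so that detour can be cut out.
  bypass-pendent : ∀ v {w} → (∀ z → Adj G v z → z ≡ w) → ∀ {a b k} → Walk G a b k → ∀ a′ b′ →
                   punchIn v a′ ≡ a → punchIn v b′ ≡ b → Σ ℕ λ k′ → k′ ≤ k × Walk (G - v) a′ b′ k′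
  bypass-pendent v only-w here a′ b′ refl b≡ with punchIn-injective v a′ b′ (sym b≡)
  ... | refl = 0 , z≤n , here
  bypass-pendent v only-w (step {w = y} e p) a′ b′ refl b≡ with v ≟ᶠ y
  ... | no v≢y with unpunch v v≢y
  ...   | y′ , refl with bypass-pendent v only-w p y′ b′ refl b≡
  ...     | k′ , k′≤k , q = suc k′ , s≤s k′≤k , step e q
  bypass-pendent v only-w (step e p) a′ b′ refl b≡ | yes refl with p
  ... | here = ⊥-elim (punchInᵢ≢i v b′ b≡)
  ... | step e′ p′
    with bypass-pendent v only-w p′ a′ b′ (trans (only-w _ (Adj-sym G e)) (sym (only-w _ e′))) b≡
  ...   | k′ , k′≤k , q = k′ , m≤n⇒m≤1+n (m≤n⇒m≤1+n k′≤k) , q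

HasEccentricityPreservingLeaf : ∀ {m} → Graph (suc m) → Set
HasEccentricityPreservingLeaf {m} G = Σ (Fin (suc m)) λ v → Pendent G v ×
  ((u : Fin m) (e : ℕ) → IsEcc G (punchIn v u) e ⇔ IsEcc (G - v) u e)

module Tree {m : ℕ} (G : Graph (suc m)) (tree : IsTree G) where
  open Deletion G
  open Distance G (proj₁ tree)

  acyclic : ¬ HasCycle G
  acyclic = proj₂ tree

  avoids-or-farther : ∀ x c′ y′ → Walk (G - x) c′ y′ (dist (punchIn x c′) (punchIn x y′))
                                ⊎ dist (punchIn x c′) x < dist (punchIn x c′) (punchIn x y′)
  avoids-or-farther x c′ y′ with avoids-or-through x (dist-walk (punchIn x c′) (punchIn x y′)) c′ y′ refl refl
  ... | inj₁ q = inj₁ q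
  ... | inj₂ (k₁ , k₂ , q₁ , q₂ , k≡) =
    inj₂ (subst (_ ≤_) k≡ (subst (_≤ k₁ + k₂) (+-comm _ 1)
           (+-mono-≤ (dist-minimal q₁) (≢⇒walk-nonempty (≢-sym (punchInᵢ≢i x y′)) q₂))))

  one-neighbour-farther : ∀ {c x y z} → c ≢ x → Adj G x y → Adj G x z → y ≢ z →
                          dist c x < dist c y ⊎ dist c x < dist c z
  one-neighbour-farther {x = x} c≢x xy xz y≢z
    with unpunch x (≢-sym c≢x) | unpunch x (Adj⇒≢ G xy) | unpunch x (Adj⇒≢ G xz)
  ... | c′ , refl | y′ , refl | z′ , refl with avoids-or-farther x c′ y′ | avoids-or-farther x c′ z′
  ...   | inj₂ y-farther | _              = inj₁ y-farther
  ...   | inj₁ _         | inj₂ z-farther = inj₂ z-farther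
  ...   | inj₁ p         | inj₁ q         =
    ⊥-elim (acyclic⇒neighbours-disconnected acyclic x xy xz y≢z (reverseʷ p ++ʷ q))

  NeverUniquelyFarthest : Fin (suc m) → Set
  NeverUniquelyFarthest v = ∀ u → Σ (Fin (suc m)) λ x → x ≢ v × dist u v ≤ dist u x

  module PendentDeletion (v : Fin (suc m)) {w} (only-w : ∀ z → Adj G v z → z ≡ w) where

    isDist-delete⁺ : ∀ {u′ x′ k} → IsDist (G - v) u′ x′ k → IsDist G (punchIn v u′) (punchIn v x′) k
    isDist-delete⁺ {u′} {x′} {k} (p , minimal) = liftʷ v p , shortest
      where
      shortest : ∀ l → Walk G (punchIn v u′) (punchIn v x′) l → k ≤ l
      shortest l q with bypass-pendent v only-w q u′ x′ refl refl
      ... | k′ , k′≤l , q′ = ≤-trans (minimal k′ q′) k′≤l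

    isDist-delete⁻ : ∀ {u′ x′ k} → IsDist G (punchIn v u′) (punchIn v x′) k → IsDist (G - v) u′ x′ k
    isDist-delete⁻ {u′} {x′} (p , minimal) with bypass-pendent v only-w p u′ x′ refl refl
    ... | k′ , k′≤k , q =
      subst (Walk (G - v) u′ x′) (≤-antisym k′≤k (minimal k′ (liftʷ v q))) q , λ l q → minimal l (liftʷ v q)

    ecc-delete : NeverUniquelyFarthest v → ∀ u′ e → IsEcc G (punchIn v u′) e ⇔ IsEcc (G - v) u′ e
    ecc-delete never-farthest u′ e with never-farthest (punchIn v u′)
    ... | x₀ , x₀≢v , v-closer with unpunch v (≢-sym x₀≢v)
    ...   | x₀′ , refl = mk⇔ to from
      where
      u = punchIn v u′
      x₀-isDist : IsDist (G - v) u′ x₀′ (dist u (punchIn v x₀′))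
      x₀-isDist = isDist-delete⁻ (dist-isDist u _)

      to : IsEcc G u e → IsEcc (G - v) u′ e
      to (bounded , x , x-at-e) = (λ y′ k d → bounded (punchIn v y′) k (isDist-delete⁺ d)) , witness x x-at-e
        where
        witness : ∀ x → IsDist G u x e → ∃ λ x′ → IsDist (G - v) u′ x′ e
        witness x x-at-e with v ≟ᶠ x
        ... | no v≢x with unpunch v v≢x
        ...   | x′ , refl = x′ , isDist-delete⁻ x-at-e
        witness x x-at-e | yes refl = x₀′ , subst (IsDist (G - v) u′ x₀′) (sym e≡) x₀-isDist
          where
          e≡ : e ≡ dist u (punchIn v x₀′)
          e≡ = ≤-antisym (subst (_≤ _) (sym (isDist⇒≡dist x-at-e)) v-closer) (bounded _ _ (dist-isDist u _))

      from : IsEcc (G - v) u′ e → IsEcc G u e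
      from (bounded , x′ , x′-at-e) = bounded′ , punchIn v x′ , isDist-delete⁺ x′-at-e
        where
        bounded′ : ∀ y k → IsDist G u y k → k ≤ e
        bounded′ y k d with v ≟ᶠ y
        ... | no v≢y with unpunch v v≢y
        ...   | y′ , refl = bounded y′ k (isDist-delete⁻ d)
        bounded′ y k d | yes refl =
          ≤-trans (subst (_≤ _) (sym (isDist⇒≡dist d)) v-closer) (bounded x₀′ _ x₀-isDist)

  module NoBranchVertex (no-branch : ∀ v → ¬ Distinct₃ (Adj G v)) where

    a : Fin (suc m)
    a = proj₁ (maximiser-all (dist fzero))

    a-farthest : ∀ y → dist fzero y ≤ dist fzero a
    a-farthest = proj₂ (maximiser-all (dist fzero))

    a-leaf : ∀ {y z} → Adj G a y → Adj G a z → y ≡ z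
    a-leaf {y} {z} ay az with y ≟ᶠ z | fzero ≟ᶠ a
    ... | yes y≡z | _ = y≡z
    ... | no _ | yes 0≡a = ⊥-elim (Adj⇒≢ G ay (trans (sym 0≡a) (dist≡0⇒≡ (n≤0⇒n≡0 y-near))))
      where
      y-near : dist fzero y ≤ 0
      y-near = ≤-trans (a-farthest y) (≤-reflexive (trans (cong (dist fzero) (sym 0≡a)) (dist-refl fzero)))
    ... | no y≢z | no 0≢a with one-neighbour-farther 0≢a ay az y≢z
    ...   | inj₁ y-farther = ⊥-elim (<⇒≱ y-farther (a-farthest y))
    ...   | inj₂ z-farther = ⊥-elim (<⇒≱ z-farther (a-farthest z))

    δ : Fin (suc m) → ℕ
    δ = dist a

    children-unique : ∀ k {p x y} → δ p ≡ k → Adj G p x → Adj G p y → δ x ≡ suc k → δ y ≡ suc k → x ≡ y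
    children-unique zero δp px py _ _ with dist≡0⇒≡ δp
    ... | refl = a-leaf px py
    children-unique (suc k) {p} {x} {y} δp px py δx δy with x ≟ᶠ y | predecessor a p δp
    ... | yes x≡y | _ = x≡y
    ... | no x≢y | q , qp , δq =
      ⊥-elim (no-branch p (x , y , q , px , py , Adj-sym G qp , x≢y , deeper δx , deeper δy))
      where
      deeper : ∀ {z} → δ z ≡ suc (suc k) → z ≢ q
      deeper δz refl = m≢1+n+m k {1} (trans (sym δq) δz)

    δ-injective-at : ∀ k {x y} → δ x ≡ k → δ y ≡ k → x ≡ y
    δ-injective-at zero δx δy = trans (sym (dist≡0⇒≡ δx)) (dist≡0⇒≡ δy)
    δ-injective-at (suc k) {x} {y} δx δy with predecessor a x δx | predecessor a y δy
    ... | p , px , δp | p′ , p′y , δp′ with δ-injective-at k δp δp′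
    ...   | refl = children-unique k δp px p′y δx δy

    δ-injective : ∀ {x y} → δ x ≡ δ y → x ≡ y
    δ-injective δx≡δy = δ-injective-at _ δx≡δy refl

    ancestor : ∀ d {x} → δ x ≡ d → ∀ j → j ≤ d → ∃ λ y → δ y ≡ j
    ancestor zero {x} δx j j≤0 = x , trans δx (sym (n≤0⇒n≡0 j≤0))
    ancestor (suc d) {x} δx j j≤d with j ≟ suc d
    ... | yes refl = x , δx
    ... | no j≢d with predecessor a x δx
    ...   | p , _ , δp = ancestor d δp j (≤-pred (≤∧≢⇒< j≤d j≢d))

    δ-bounded : ∀ x → δ x < suc m
    δ-bounded x = injective⇒≤ {f = ancestor-at} ancestor-injective
      where
      ancestor-at : Fin (suc (δ x)) → Fin (suc m)
      ancestor-at j = proj₁ (ancestor (δ x) refl (toℕ j) (≤-pred (toℕ<n j)))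
      ancestor-injective : ∀ {i j} → ancestor-at i ≡ ancestor-at j → i ≡ j
      ancestor-injective {i} {j} eq = toℕ-injective (trans (sym (proj₂ (ancestor (δ x) refl (toℕ i) _)))
                                        (trans (cong δ eq) (proj₂ (ancestor (δ x) refl (toℕ j) _))))

    δ-exhaustive : ∀ j → j ≤ m → ∃ λ y → δ y ≡ j
    δ-exhaustive j j≤m = ancestor (δ b) refl j (≤-trans j≤m m≤δb)
      where
      b = proj₁ (maximiser-all δ)
      b-farthest = proj₂ (maximiser-all δ)
      m≤δb : m ≤ δ b
      m≤δb = ≤-pred (injective⇒≤ {f = λ x → fromℕ< (s≤s (b-farthest x))}
                       λ {x} {y} eq → δ-injective (trans (sym (toℕ-fromℕ< _)) (trans (cong toℕ eq) (toℕ-fromℕ< _))))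

    number : Fin (suc m) → Fin (suc m)
    number x = fromℕ< (δ-bounded x)

    toℕ-number : ∀ x → toℕ (number x) ≡ δ x
    toℕ-number x = toℕ-fromℕ< (δ-bounded x)

    Adj⇔consecutive : ∀ {i j} → Adj G i j ⇔ Consecutive (δ i) (δ j)
    Adj⇔consecutive {i} {j} = mk⇔ to from
      where
      to : Adj G i j → Consecutive (δ i) (δ j)
      to ij with <-cmp (δ i) (δ j)
      ... | tri< δi<δj _ _ = inj₁ (≤-antisym δi<δj (dist-adj a ij))
      ... | tri≈ _ δi≡δj _ = ⊥-elim (Adj⇒≢ G ij (δ-injective δi≡δj))
      ... | tri> _ _ δj<δi = inj₂ (≤-antisym δj<δi (dist-adj a (Adj-sym G ij)))
      child⇒Adj : ∀ {x y} → suc (δ x) ≡ δ y → Adj G x y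
      child⇒Adj {x} {y} δy≡ with predecessor a y (sym δy≡)
      ... | p , py , δp = subst (λ q → Adj G q y) (δ-injective δp) py
      from : Consecutive (δ i) (δ j) → Adj G i j
      from (inj₁ δj≡) = child⇒Adj δj≡
      from (inj₂ δi≡) = Adj-sym G (child⇒Adj δi≡)

    ≅-path : G ≅ P (suc m)
    ≅-path = mk⤖ {to = number} (number-injective , number-surjective) ,
             λ i j → T⇔T⇒≡ (adj-number⁺ i j) (adj-number⁻ i j)
      where
      number-injective : ∀ {x y} → number x ≡ number y → x ≡ y
      number-injective {x} {y} eq = δ-injective (trans (sym (toℕ-number x)) (trans (cong toℕ eq) (toℕ-number y)))
      number-surjective : ∀ j → ∃ λ x → ∀ {z} → z ≡ x → number z ≡ j
      number-surjective j with δ-exhaustive (toℕ j) (≤-pred (toℕ<n j))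
      ... | y , δy = y , λ { refl → toℕ-injective (trans (toℕ-number y) δy) }
      adj-number⁺ : ∀ i j → Adj G i j → Adj (P (suc m)) (number i) (number j)
      adj-number⁺ i j ij = Equivalence.from Adj-P⇔
        (subst₂ Consecutive (sym (toℕ-number i)) (sym (toℕ-number j)) (Equivalence.to (Adj⇔consecutive {i} {j}) ij))
      adj-number⁻ : ∀ i j → Adj (P (suc m)) (number i) (number j) → Adj G i j
      adj-number⁻ i j t = Equivalence.from (Adj⇔consecutive {i} {j})
        (subst₂ Consecutive (toℕ-number i) (toℕ-number j) (Equivalence.to Adj-P⇔ t))

  module BranchVertex (c : Fin (suc m)) where

    -- For a neighbour ci of c, the branch through ci: the component of T - c containing ci.
    InBranch : Fin (suc m) → Fin (suc m) → Set
    InBranch ci x = dist ci x < dist c x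

    InBranch⇒≢ : ∀ {ci x} → InBranch ci x → c ≢ x
    InBranch⇒≢ {ci} x-in refl = n≮0 (subst (dist ci c <_) (dist-refl c) x-in)

    InBranch-self : ∀ {ci} → Adj G c ci → InBranch ci ci
    InBranch-self {ci} c-ci = subst (_< dist c ci) (sym (dist-refl ci)) (≢⇒dist-pos (Adj⇒≢ G c-ci))

    InBranch-outward : ∀ {ci x y} → InBranch ci x → Adj G x y → dist c x < dist c y → InBranch ci y
    InBranch-outward {ci} x-in xy farther = ≤-<-trans (≤-trans (dist-adj ci xy) x-in) farther

    InBranch⇒walk-avoiding : ∀ ci′ x′ → InBranch (punchIn c ci′) (punchIn c x′) →
                             ∃ λ k → Walk (G - c) ci′ x′ k
    InBranch⇒walk-avoiding ci′ x′ x-in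
      with avoids-or-through c (dist-walk (punchIn c ci′) (punchIn c x′)) ci′ x′ refl refl
    ... | inj₁ q = _ , q
    ... | inj₂ (k₁ , k₂ , q₁ , q₂ , k≡) =
      ⊥-elim (<⇒≱ x-in (subst (_ ≤_) k≡ (≤-trans (dist-minimal q₂) (m≤n+m k₂ k₁))))

    walk-avoiding⇒InBranch : ∀ {ci′ u′ k} → Adj G c (punchIn c ci′) → Walk (G - c) ci′ u′ k →
                             InBranch (punchIn c ci′) (punchIn c u′)
    walk-avoiding⇒InBranch {ci′} {u′} c-ci p with dist c (punchIn c u′) in d≡
    ... | zero  = ⊥-elim (punchInᵢ≢i c u′ (sym (dist≡0⇒≡ d≡)))
    ... | suc d with first-step (subst (Walk G c _) d≡ (dist-walk c _))
    ...   | w , c-w , q with w ≟ᶠ punchIn c ci′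
    ...     | yes refl = s≤s (dist-minimal q)
    ...     | no w≢ci with unpunch c (Adj⇒≢ G c-w)
    ...       | w′ , refl with avoids-or-through c q w′ u′ refl refl
    ...         | inj₁ q′ = ⊥-elim (acyclic⇒neighbours-disconnected acyclic c c-w c-ci w≢ci (q′ ++ʷ reverseʷ p))
    ...         | inj₂ (k₁ , k₂ , q₁ , q₂ , k≡) =
      ⊥-elim (1+n≰n (≤-trans (n≤1+n (suc d)) (subst (suc (suc d) ≤_) k≡
        (+-mono-≤ (≢⇒walk-nonempty (punchInᵢ≢i c w′) q₁) (subst (_≤ k₂) d≡ (dist-minimal q₂))))))

    branches-disjoint : ∀ {ci cj x} → Adj G c ci → Adj G c cj → ci ≢ cj → InBranch ci x → ¬ InBranch cj x
    branches-disjoint c-ci c-cj ci≢cj x-in-i x-in-j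
      with unpunch c (Adj⇒≢ G c-ci) | unpunch c (Adj⇒≢ G c-cj) | unpunch c (InBranch⇒≢ x-in-i)
    ... | ci′ , refl | cj′ , refl | x′ , refl
      with InBranch⇒walk-avoiding ci′ x′ x-in-i | InBranch⇒walk-avoiding cj′ x′ x-in-j
    ...   | _ , p | _ , q = acyclic⇒neighbours-disconnected acyclic c c-ci c-cj ci≢cj (p ++ʷ reverseʷ q)

    dist-via-centre : ∀ {ck u x} → Adj G c ck → ¬ InBranch ck u → InBranch ck x → dist u c + dist c x ≤ dist u x
    dist-via-centre {ck} {u} {x} c-ck u∉ x-in with c ≟ᶠ u
    ... | yes refl = ≤-reflexive (cong (_+ dist c x) (dist-refl c))
    ... | no c≢u with unpunch c c≢u | unpunch c (InBranch⇒≢ x-in) | unpunch c (Adj⇒≢ G c-ck)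
    ...   | u′ , refl | x′ , refl | ck′ , refl
      with avoids-or-through c (dist-walk (punchIn c u′) (punchIn c x′)) u′ x′ refl refl
    ...     | inj₂ (k₁ , k₂ , q₁ , q₂ , k≡) =
      subst (dist (punchIn c u′) c + dist c (punchIn c x′) ≤_) k≡ (+-mono-≤ (dist-minimal q₁) (dist-minimal q₂))
    ...     | inj₁ q with InBranch⇒walk-avoiding ck′ x′ x-in
    ...       | _ , p = ⊥-elim (u∉ (walk-avoiding⇒InBranch c-ck (p ++ʷ reverseʷ q)))

    Deepest : Fin (suc m) → Fin (suc m) → Set
    Deepest ci v = InBranch ci v × (∀ y → InBranch ci y → dist c y ≤ dist c v)

    deepest : ∀ {ci} → Adj G c ci → ∃ (Deepest ci)
    deepest {ci} c-ci = maximiser (λ x → dist ci x <? dist c x) (dist c) (InBranch-self c-ci)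

    height : ∀ {ci} → Adj G c ci → ℕ
    height c-ci = dist c (proj₁ (deepest c-ci))

    deepest-leaf : ∀ {ci v y z} → Deepest ci v → Adj G v y → Adj G v z → y ≡ z
    deepest-leaf {y = y} {z} (v-in , v-deepest) vy vz with y ≟ᶠ z
    ... | yes y≡z = y≡z
    ... | no y≢z with one-neighbour-farther (InBranch⇒≢ v-in) vy vz y≢z
    ...   | inj₁ y-farther = ⊥-elim (<⇒≱ y-farther (v-deepest _ (InBranch-outward v-in vy y-farther)))
    ...   | inj₂ z-farther = ⊥-elim (<⇒≱ z-farther (v-deepest _ (InBranch-outward v-in vz z-farther)))

    lowest-branch-leaf : ∀ {c₁ c₂ c₃} (c-c₁ : Adj G c c₁) (c-c₂ : Adj G c c₂) (c-c₃ : Adj G c c₃) →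
                         c₁ ≢ c₂ → c₁ ≢ c₃ → c₂ ≢ c₃ →
                         height c-c₁ ≤ height c-c₂ → height c-c₁ ≤ height c-c₃ →
                         HasEccentricityPreservingLeaf G
    lowest-branch-leaf {c₁} {c₂} {c₃} c-c₁ c-c₂ c-c₃ c₁≢c₂ c₁≢c₃ c₂≢c₃ h₁≤h₂ h₁≤h₃ =
      v , unique-neighbour⇒pendent G v vw only-w , PendentDeletion.ecc-delete v only-w never-farthest
      where
      v = proj₁ (deepest c-c₁)
      v-deepest = proj₂ (deepest c-c₁)
      x₂ = proj₁ (deepest c-c₂)
      x₂-in = proj₁ (proj₂ (deepest c-c₂))
      x₃ = proj₁ (deepest c-c₃)
      x₃-in = proj₁ (proj₂ (deepest c-c₃))
      vw = proj₂ (≢⇒neighbour (≢-sym (InBranch⇒≢ (proj₁ v-deepest))) (dist-walk v c))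
      only-w : ∀ z → Adj G v z → z ≡ _
      only-w z vz = deepest-leaf v-deepest vz vw
      outside : ∀ {ck x} → ck ≢ c₁ → Adj G c ck → InBranch ck x → x ≢ v
      outside ck≢c₁ c-ck x-in refl = branches-disjoint c-c₁ c-ck (≢-sym ck≢c₁) (proj₁ v-deepest) x-in
      beyond : ∀ {ck x} u → Adj G c ck → ¬ InBranch ck u → InBranch ck x →
               dist c v ≤ dist c x → dist u v ≤ dist u x
      beyond u c-ck u∉ x-in v≤x = ≤-trans (dist-triangle u c v)
                                     (≤-trans (+-monoʳ-≤ (dist u c) v≤x) (dist-via-centre c-ck u∉ x-in))
      never-farthest : NeverUniquelyFarthest v
      never-farthest u with dist c₂ u <? dist c u
      ... | no u∉₂ = x₂ , outside (≢-sym c₁≢c₂) c-c₂ x₂-in , beyond u c-c₂ u∉₂ x₂-in h₁≤h₂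
      ... | yes u∈₂ = x₃ , outside (≢-sym c₁≢c₃) c-c₃ x₃-in ,
                      beyond u c-c₃ (branches-disjoint c-c₂ c-c₃ c₂≢c₃ u∈₂) x₃-in h₁≤h₃

    branch-vertex⇒leaf : 3 ≤ degree G c → HasEccentricityPreservingLeaf G
    branch-vertex⇒leaf deg≥3 with degree≥3⇒Distinct₃ G c deg≥3
    ... | c₁ , c₂ , c₃ , c-c₁ , c-c₂ , c-c₃ , c₁≢c₂ , c₁≢c₃ , c₂≢c₃
      with height c-c₁ ≤? height c-c₂ | height c-c₁ ≤? height c-c₃ | height c-c₂ ≤? height c-c₃
    ... | yes h₁≤h₂ | yes h₁≤h₃ | _ =
      lowest-branch-leaf c-c₁ c-c₂ c-c₃ c₁≢c₂ c₁≢c₃ c₂≢c₃ h₁≤h₂ h₁≤h₃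
    ... | no h₁≰h₂ | _ | yes h₂≤h₃ =
      lowest-branch-leaf c-c₂ c-c₁ c-c₃ (≢-sym c₁≢c₂) c₂≢c₃ c₁≢c₃ (≰⇒≥ h₁≰h₂) h₂≤h₃
    ... | yes h₁≤h₂ | no h₁≰h₃ | _ =
      lowest-branch-leaf c-c₃ c-c₁ c-c₂ (≢-sym c₁≢c₃) (≢-sym c₂≢c₃) c₁≢c₂
        (≰⇒≥ h₁≰h₃) (≤-trans (≰⇒≥ h₁≰h₃) h₁≤h₂)
    ... | no h₁≰h₂ | _ | no h₂≰h₃ =
      lowest-branch-leaf c-c₃ c-c₁ c-c₂ (≢-sym c₁≢c₃) (≢-sym c₂≢c₃) c₁≢c₂
        (≤-trans (≰⇒≥ h₂≰h₃) (≰⇒≥ h₁≰h₂)) (≰⇒≥ h₂≰h₃)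

mainTheorem6 : (m : ℕ) (T : Graph (suc m)) → IsTree T → ¬ (T ≅ P (suc m)) →
    Σ (Fin (suc m)) λ v → Pendent T v ×
      ((u : Fin m) (e : ℕ) → IsEcc T (punchIn v u) e ⇔ IsEcc (T - v) u e)
mainTheorem6 m T tree T≇P with any? (λ c → 3 ≤? degree T c)
... | yes (c , deg≥3) = Tree.BranchVertex.branch-vertex⇒leaf T tree c deg≥3
... | no ¬branch      = ⊥-elim (T≇P (Tree.NoBranchVertex.≅-path T tree
                          (λ v three → ¬branch (v , Distinct₃⇒degree≥3 T v three))))
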